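{- For every integer $m>0$, $G_m(\lambda)$ is a polynomial in $\lambda$ of degree $m$ with zero constant term. Writing $G_m(\lambda)=\sum_{k=1}^m (-1)^{k-1} g(m,k)\lambda^k$, and setting $g(m,k)=0$ for $k>m>0$ and $g(m,0)=0$, one has for all $m>1$ and $1\le k\le m$: $$k\cdot g(m,k)=g(m-1,k)+g(m-1,k-1).$$
   Context: Let $T(z)=\sum_{n\ge1} n^{n-1}\frac{z^n}{n!}$ and, for each integer $m$, let $R_m(z)=\sum_{n\ge1} n^{n-m}\frac{z^n}{n!}$. The compositional inverse of $T$ is $z=\lambda e^{ -\lambda}$. Define the formal power series $G_m(\lambda)$ by $G_m(T(z))=R_m(z)$, i.e. $G_m(\lambda)=R_m(\lambda e^{ -\lambda})$. -}

module Defs where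

open import Data.Nat as ℕ using (ℕ; zero; suc; _∸_; _!)
open import Data.Nat.Properties using (m^n≢0; m*n≢0; _!≢0)
open import Data.Integer using (+_)
open import Data.Rational using (ℚ; 0ℚ; 1ℚ; _+_; _*_; -_; _/_)

PowerSeries : Set
PowerSeries = ℕ → ℚ

sumTo : ℕ → (ℕ → ℚ) → ℚ
sumTo zero    f = f zero
sumTo (suc n) f = sumTo n f + f (suc n)

_⊛_ : PowerSeries → PowerSeries → PowerSeries
(a ⊛ b) n = sumTo n (λ i → a i * b (n ∸ i))

one : PowerSeries
one zero    = 1ℚ
one (suc _) = 0ℚ

pow : PowerSeries → ℕ → PowerSeries
pow a zero    = one
pow a (suc n) = a ⊛ pow a n

-- Composition f(s) for s with zero constant term:
-- [x^N] f(s(x)) = Σ_{n=0}^{N} f_n [x^N] s(x)^n  (higher powers of s contribute nothing).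
compose : PowerSeries → PowerSeries → PowerSeries
compose f s N = sumTo N (λ n → f n * pow s n N)

_^ℚ_ : ℚ → ℕ → ℚ
q ^ℚ zero  = 1ℚ
q ^ℚ suc n = q * (q ^ℚ n)

-1ℚ : ℚ
-1ℚ = - 1ℚ

-- the series  λ e^{-λ}  : coefficient of λ^{k+1} is (-1)^k / k!
lamExpNeg : PowerSeries
lamExpNeg zero    = 0ℚ
lamExpNeg (suc k) = (-1ℚ ^ℚ k) * _/_ (+ 1) (k !) {{k !≢0}}

-- R_m(z) = Σ_{n≥1} n^{n-m} z^n / n!  (m a natural number; n^{n-m} is a rational
-- number when n < m).  For n ≥ 1:  n^{n-m}/n! = n^{n ∸ m} / (n^{m ∸ n} · n!).
R : ℕ → PowerSeries
R m zero    = 0ℚ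
R m (suc j) =
  _/_ (+ (suc j ℕ.^ (suc j ∸ m))) (suc j ℕ.^ (m ∸ suc j) ℕ.* (suc j !))
    {{m*n≢0 (suc j ℕ.^ (m ∸ suc j)) (suc j !) {{m^n≢0 (suc j) (m ∸ suc j)}} {{suc j !≢0}}}}

G : ℕ → PowerSeries
G m = compose (R m) lamExpNeg

-- g(m,k) = (-1)^{k-1} [λ^k] G_m  for k ≥ 1, and g(m,0) = 0.
-- (For k > m this coefficient is 0 by the first part of the statement, matching
-- the convention g(m,k) = 0 for k > m.)
g : ℕ → ℕ → ℚ
g m zero    = 0ℚ
g m (suc j) = (-1ℚ ^ℚ j) * G m (suc j)

module Submission where

-- Since (λ e^{-λ})ⁿ = λⁿ e^{-nλ}, the coefficient of λ^N in G_m is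
-- (-1)^N / N! · Σ_n C(N,n) (-1)ⁿ n^{N-m}  (n ≥ 1), an N-th finite difference of the
-- polynomial n ↦ n^{N-m}: it vanishes for N > m, and for N = m it equals -(-1)^m / m!
-- because the n = 0 term is missing.  The recurrence is the coefficient form of
-- λ G′_{m+1} = (1 - λ) G_m, obtained termwise from R_m(n) = n R_{m+1}(n) and the Euler
-- identity λ c′ = n c - n λ c for c = λⁿ e^{-nλ}.

open import Defs
open import Data.Nat using (ℕ; suc; _<_; _≤_; _∸_)
open import Data.Integer using (+_)
open import Data.Rational using (ℚ; 0ℚ; _+_; _*_; _/_)
open import Data.Product using (_×_; _,_)
open import Relation.Binary.PropositionalEquality using (_≡_; _≢_)

import Data.Integer as ℤ
import Data.Integer.Properties as ℤP
open import Data.Nat as ℕ using (zero; NonZero; z≤n; s≤s; _!; _^_)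
import Data.Nat.Properties as ℕP
open import Data.Nat.Properties using (_!≢0; m^n≢0)
open import Data.Nat.Combinatorics
  using (_C_; nCk≡n!/k![n-k]!; k>n⇒nCk≡0; nCk+nC[k+1]≡[n+1]C[k+1]; k![n∸k]!∣n!)
open import Data.Nat.DivMod using (m/n*n≡m)
open import Data.Rational using (1ℚ; -_; _-_; toℚᵘ)
open import Data.Rational.Properties
  using ( +-identityˡ; +-identityʳ; +-assoc; +-inverseʳ; *-zeroˡ; *-zeroʳ; *-identityˡ; *-identityʳ
        ; *-assoc; *-comm; *-distribˡ-+; *-distribʳ-+; neg-distribʳ-*
        ; toℚᵘ-injective; toℚᵘ-fromℚᵘ; toℚᵘ-homo-*; toℚᵘ-homo-+; fromℚᵘ-cong )
open import Data.Rational.Solver using (module +-*-Solver)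
open import Data.Rational.Unnormalised as ℚᵘ using (mkℚᵘ; *≡*)
import Data.Rational.Unnormalised.Properties as ℚᵘP
open import Relation.Binary.PropositionalEquality
  using (refl; sym; trans; cong; cong₂; _≗_; module ≡-Reasoning)

open +-*-Solver
open ≡-Reasoning

ι : ℕ → ℚ
ι n = + n / 1

1/ℕ : (n : ℕ) .{{_ : NonZero n}} → ℚ
1/ℕ n = + 1 / n

1/[_!] : ℕ → ℚ
1/[ n !] = 1/ℕ (n !) {{n !≢0}}

private
  toℚᵘ-/ : ∀ a b .{{_ : NonZero b}} → toℚᵘ (+ a / b) ℚᵘ.≃ (+ a) ℚᵘ./ b
  toℚᵘ-/ a (suc b) = toℚᵘ-fromℚᵘ (mkℚᵘ (+ a) b)

/-homo-* : ∀ a b c d .{{_ : NonZero b}} .{{_ : NonZero d}} →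
           (+ a / b) * (+ c / d) ≡ _/_ (+ (a ℕ.* c)) (b ℕ.* d) {{ℕP.m*n≢0 b d}}
/-homo-* a b@(suc _) c d@(suc _) = toℚᵘ-injective (ℚᵘP.≃-trans (toℚᵘ-homo-* (+ a / b) (+ c / d))
  (ℚᵘP.≃-trans (ℚᵘP.*-cong (toℚᵘ-/ a b) (toℚᵘ-/ c d))
  (ℚᵘP.≃-trans (ℚᵘP.≃-reflexive (cong (ℚᵘ._/ (b ℕ.* d)) (sym (ℤP.pos-* a c))))
               (ℚᵘP.≃-sym (toℚᵘ-/ (a ℕ.* c) (b ℕ.* d) {{ℕP.m*n≢0 b d}})))))

/-cross : ∀ a b c d .{{_ : NonZero b}} .{{_ : NonZero d}} →
          a ℕ.* d ≡ c ℕ.* b → + a / b ≡ + c / d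
/-cross a (suc b) c (suc d) eq = fromℚᵘ-cong {mkℚᵘ (+ a) b} {mkℚᵘ (+ c) d}
  (*≡* (trans (sym (ℤP.pos-* a (suc d))) (trans (cong +_ eq) (ℤP.pos-* c (suc b)))))

ι-homo-* : ∀ a b → ι (a ℕ.* b) ≡ ι a * ι b
ι-homo-* a b = sym (/-homo-* a 1 b 1)

ι-homo-+ : ∀ a b → ι (a ℕ.+ b) ≡ ι a + ι b
ι-homo-+ a b = sym (toℚᵘ-injective
  (ℚᵘP.≃-trans (toℚᵘ-homo-+ (ι a) (ι b))
  (ℚᵘP.≃-trans (ℚᵘP.+-cong (toℚᵘ-/ a 1) (toℚᵘ-/ b 1))
  (ℚᵘP.≃-trans (*≡* eq) (ℚᵘP.≃-sym (toℚᵘ-/ (a ℕ.+ b) 1))))))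
  where
  eq : ((+ a) ℤ.* (+ 1) ℤ.+ (+ b) ℤ.* (+ 1)) ℤ.* (+ 1) ≡ (+ (a ℕ.+ b)) ℤ.* (+ 1)
  eq = begin
    ((+ a) ℤ.* (+ 1) ℤ.+ (+ b) ℤ.* (+ 1)) ℤ.* (+ 1) ≡⟨ ℤP.*-identityʳ _ ⟩
    (+ a) ℤ.* (+ 1) ℤ.+ (+ b) ℤ.* (+ 1)             ≡⟨ cong₂ ℤ._+_ (ℤP.*-identityʳ (+ a)) (ℤP.*-identityʳ (+ b)) ⟩
    + a ℤ.+ + b                                     ≡⟨ ℤP.pos-+ a b ⟨
    + (a ℕ.+ b)                                     ≡⟨ ℤP.*-identityʳ _ ⟨
    (+ (a ℕ.+ b)) ℤ.* (+ 1)                         ∎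

ι-suc : ∀ n → ι (suc n) ≡ 1ℚ + ι n
ι-suc = ι-homo-+ 1

ι-homo-^ : ∀ n r → ι (n ^ r) ≡ ι n ^ℚ r
ι-homo-^ n zero    = refl
ι-homo-^ n (suc r) = trans (ι-homo-* n (n ^ r)) (cong (ι n *_) (ι-homo-^ n r))

/-as-* : ∀ a b .{{_ : NonZero b}} → + a / b ≡ ι a * 1/ℕ b
/-as-* a b = sym (trans (/-homo-* a 1 1 b)
  (/-cross (a ℕ.* 1) (1 ℕ.* b) a b {{ℕP.m*n≢0 1 b}}
    (ℕP.*-assoc a 1 b)))

ι-*-1/ℕ : ∀ b .{{_ : NonZero b}} → ι b * 1/ℕ b ≡ 1ℚ
ι-*-1/ℕ b = trans (/-homo-* b 1 1 b)
  (/-cross (b ℕ.* 1) (1 ℕ.* b) 1 1 {{ℕP.m*n≢0 1 b}}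
    (trans (ℕP.*-identityʳ _) (trans (ℕP.*-identityʳ b) (sym (trans (ℕP.*-identityˡ _) (ℕP.*-identityˡ b))))))

1/ℕ-homo-* : ∀ a b .{{_ : NonZero a}} .{{_ : NonZero b}} →
             1/ℕ (a ℕ.* b) {{ℕP.m*n≢0 a b}} ≡ 1/ℕ a * 1/ℕ b
1/ℕ-homo-* a b = sym (/-homo-* 1 a 1 b)

ι-cancelˡ : ∀ b .{{_ : NonZero b}} {p q : ℚ} → ι b * p ≡ ι b * q → p ≡ q
ι-cancelˡ b {p} {q} eq = trans (sym (1/ℕ-*-ι-* p)) (trans (cong (1/ℕ b *_) eq) (1/ℕ-*-ι-* q))
  where
  1/ℕ-*-ι-* : ∀ x → 1/ℕ b * (ι b * x) ≡ x
  1/ℕ-*-ι-* x = begin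
    1/ℕ b * (ι b * x)  ≡⟨ solve 3 (λ u i x → u :* (i :* x) := (i :* u) :* x) refl (1/ℕ b) (ι b) x ⟩
    (ι b * 1/ℕ b) * x  ≡⟨ cong (_* x) (ι-*-1/ℕ b) ⟩
    1ℚ * x             ≡⟨ *-identityˡ x ⟩
    x                  ∎

1/[!]-*-1/[!] : ∀ {N i} → i ≤ N → 1/[ i !] * 1/[ (N ∸ i) !] ≡ 1/[ N !] * ι (N C i)
1/[!]-*-1/[!] {N} {i} i≤N = begin
  1/[ i !] * 1/[ (N ∸ i) !]                   ≡⟨ 1/ℕ-homo-* (i !) ((N ∸ i) !) {{i !≢0}} {{(N ∸ i) !≢0}} ⟨
  1/ℕ (i ! ℕ.* (N ∸ i) !) {{i![N∸i]!≢0}}      ≡⟨ /-cross 1 _ (N C i) (N !) {{i![N∸i]!≢0}} {{N !≢0}} N!≡NCi*i![N∸i]! ⟩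
  _/_ (+ (N C i)) (N !) {{N !≢0}}             ≡⟨ /-as-* (N C i) (N !) {{N !≢0}} ⟩
  ι (N C i) * 1/[ N !]                        ≡⟨ *-comm (ι (N C i)) 1/[ N !] ⟩
  1/[ N !] * ι (N C i)                        ∎
  where
  i![N∸i]!≢0 = ℕP.m*n≢0 (i !) ((N ∸ i) !) {{i !≢0}} {{(N ∸ i) !≢0}}
  N!≡NCi*i![N∸i]! : 1 ℕ.* N ! ≡ (N C i) ℕ.* (i ! ℕ.* (N ∸ i) !)
  N!≡NCi*i![N∸i]! = trans (ℕP.*-identityˡ (N !)) (sym (trans
    (cong (ℕ._* (i ! ℕ.* (N ∸ i) !)) (nCk≡n!/k![n-k]! i≤N))
    (m/n*n≡m {{i![N∸i]!≢0}} (k![n∸k]!∣n! i≤N))))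

^ℚ-distribˡ-+-* : ∀ a s t → a ^ℚ (s ℕ.+ t) ≡ a ^ℚ s * a ^ℚ t
^ℚ-distribˡ-+-* a zero    t = sym (*-identityˡ _)
^ℚ-distribˡ-+-* a (suc s) t = trans (cong (a *_) (^ℚ-distribˡ-+-* a s t)) (sym (*-assoc a _ _))

^ℚ-distribʳ-* : ∀ a b r → (a * b) ^ℚ r ≡ a ^ℚ r * b ^ℚ r
^ℚ-distribʳ-* a b zero    = refl
^ℚ-distribʳ-* a b (suc r) = trans (cong ((a * b) *_) (^ℚ-distribʳ-* a b r))
  (solve 4 (λ a b x y → (a :* b) :* (x :* y) := (a :* x) :* (b :* y)) refl a b (a ^ℚ r) (b ^ℚ r))

-1^n*-1^n≡1 : ∀ n → -1ℚ ^ℚ n * -1ℚ ^ℚ n ≡ 1ℚ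
-1^n*-1^n≡1 zero    = refl
-1^n*-1^n≡1 (suc n) = trans (solve 1 (λ a → (con -1ℚ :* a) :* (con -1ℚ :* a) := a :* a) refl (-1ℚ ^ℚ n))
  (-1^n*-1^n≡1 n)

-1^N*-1^n≡-1^[N∸n] : ∀ {N n} → n ≤ N → -1ℚ ^ℚ N * -1ℚ ^ℚ n ≡ -1ℚ ^ℚ (N ∸ n)
-1^N*-1^n≡-1^[N∸n] {N} {n} n≤N = begin
  -1ℚ ^ℚ N * s                   ≡⟨ cong (λ k → -1ℚ ^ℚ k * s) (ℕP.m+[n∸m]≡n n≤N) ⟨
  -1ℚ ^ℚ (n ℕ.+ (N ∸ n)) * s     ≡⟨ cong (_* s) (^ℚ-distribˡ-+-* -1ℚ n (N ∸ n)) ⟩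
  (s * -1ℚ ^ℚ (N ∸ n)) * s       ≡⟨ solve 2 (λ s t → (s :* t) :* s := t :* (s :* s)) refl s (-1ℚ ^ℚ (N ∸ n)) ⟩
  -1ℚ ^ℚ (N ∸ n) * (s * s)       ≡⟨ cong (-1ℚ ^ℚ (N ∸ n) *_) (-1^n*-1^n≡1 n) ⟩
  -1ℚ ^ℚ (N ∸ n) * 1ℚ            ≡⟨ *-identityʳ _ ⟩
  -1ℚ ^ℚ (N ∸ n)                 ∎
  where s = -1ℚ ^ℚ n

sumTo-cong : ∀ N {f g : ℕ → ℚ} → (∀ i → i ≤ N → f i ≡ g i) → sumTo N f ≡ sumTo N g
sumTo-cong zero    f≡g = f≡g 0 z≤n
sumTo-cong (suc N) f≡g = cong₂ _+_ (sumTo-cong N (λ i i≤N → f≡g i (ℕP.m≤n⇒m≤1+n i≤N))) (f≡g (suc N) ℕP.≤-refl)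

sumTo-+ : ∀ N (f g : ℕ → ℚ) → sumTo N (λ i → f i + g i) ≡ sumTo N f + sumTo N g
sumTo-+ zero    f g = refl
sumTo-+ (suc N) f g = trans (cong (_+ (f (suc N) + g (suc N))) (sumTo-+ N f g))
  (solve 4 (λ a b c d → (a :+ b) :+ (c :+ d) := (a :+ c) :+ (b :+ d)) refl
    (sumTo N f) (sumTo N g) (f (suc N)) (g (suc N)))

*-distribˡ-sumTo : ∀ N c (f : ℕ → ℚ) → c * sumTo N f ≡ sumTo N (λ i → c * f i)
*-distribˡ-sumTo zero    c f = refl
*-distribˡ-sumTo (suc N) c f = trans (*-distribˡ-+ c (sumTo N f) (f (suc N)))
  (cong (_+ c * f (suc N)) (*-distribˡ-sumTo N c f))

sumTo-sucˡ : ∀ N (f : ℕ → ℚ) → sumTo (suc N) f ≡ f 0 + sumTo N (λ i → f (suc i))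
sumTo-sucˡ zero    f = refl
sumTo-sucˡ (suc N) f = trans (cong (_+ f (suc (suc N))) (sumTo-sucˡ N f))
  (+-assoc (f 0) (sumTo N (λ i → f (suc i))) (f (suc (suc N))))

sumTo-- : ∀ N (f g : ℕ → ℚ) → sumTo N (λ i → f i - g i) ≡ sumTo N f - sumTo N g
sumTo-- zero    f g = refl
sumTo-- (suc N) f g = trans (cong (_+ (f (suc N) - g (suc N))) (sumTo-- N f g))
  (solve 4 (λ a b c d → (a :- b) :+ (c :- d) := (a :+ c) :- (b :+ d)) refl
    (sumTo N f) (sumTo N g) (f (suc N)) (g (suc N)))

binomialSum : ℕ → (ℕ → ℕ → ℚ) → ℚ
binomialSum N w = sumTo N (λ i → ι (N C i) * w i (N ∸ i))

binomialSum-cong : ∀ N {w w′ : ℕ → ℕ → ℚ} → (∀ i j → w i j ≡ w′ i j) → binomialSum N w ≡ binomialSum N w′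
binomialSum-cong N w≡w′ = sumTo-cong N (λ i _ → cong (ι (N C i) *_) (w≡w′ i (N ∸ i)))

*-distribˡ-binomialSum : ∀ N c w → c * binomialSum N w ≡ binomialSum N (λ i j → c * w i j)
*-distribˡ-binomialSum N c w = trans (*-distribˡ-sumTo N c _)
  (sumTo-cong N (λ i _ → solve 3 (λ c a b → c :* (a :* b) := a :* (c :* b)) refl c (ι (N C i)) (w i (N ∸ i))))

binomialSum-+ : ∀ N w w′ → binomialSum N (λ i j → w i j + w′ i j) ≡ binomialSum N w + binomialSum N w′
binomialSum-+ N w w′ = trans
  (sumTo-cong N (λ i _ → *-distribˡ-+ (ι (N C i)) (w i (N ∸ i)) (w′ i (N ∸ i))))
  (sumTo-+ N _ _)

binomialSum-suc : ∀ N w →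
  binomialSum (suc N) w ≡ binomialSum N (λ i j → w i (suc j)) + binomialSum N (λ i j → w (suc i) j)
binomialSum-suc N w = begin
  binomialSum (suc N) w
    ≡⟨ sumTo-sucˡ N _ ⟩
  first + sumTo N (λ i → ι (suc N C suc i) * w (suc i) (N ∸ i))
    ≡⟨ cong (λ z → first + z) (sumTo-cong N (λ i _ → cong (_* w (suc i) (N ∸ i)) (pascal i))) ⟩
  first + sumTo N (λ i → (ι (N C i) + ι (N C suc i)) * w (suc i) (N ∸ i))
    ≡⟨ cong (λ z → first + z) (sumTo-cong N (λ i _ → *-distribʳ-+ (w (suc i) (N ∸ i)) (ι (N C i)) (ι (N C suc i)))) ⟩
  first + sumTo N (λ i → ι (N C i) * w (suc i) (N ∸ i) + ι (N C suc i) * w (suc i) (N ∸ i))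
    ≡⟨ cong (λ z → first + z) (sumTo-+ N _ _) ⟩
  first + (binomialSum N (λ i j → w (suc i) j) + upper)
    ≡⟨ solve 3 (λ a x y → a :+ (x :+ y) := (a :+ y) :+ x) refl first (binomialSum N (λ i j → w (suc i) j)) upper ⟩
  (first + upper) + binomialSum N (λ i j → w (suc i) j)
    ≡⟨ cong (_+ binomialSum N (λ i j → w (suc i) j)) lower ⟩
  binomialSum N (λ i j → w i (suc j)) + binomialSum N (λ i j → w (suc i) j)
    ∎
  where
  pascal : ∀ i → ι (suc N C suc i) ≡ ι (N C i) + ι (N C suc i)
  pascal i = trans (cong ι (sym (nCk+nC[k+1]≡[n+1]C[k+1] N i))) (ι-homo-+ (N C i) (N C suc i))
  first = ι (N C 0) * w 0 (suc N)
  upper = sumTo N (λ i → ι (N C suc i) * w (suc i) (N ∸ i))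
  lower : first + upper ≡ binomialSum N (λ i j → w i (suc j))
  lower = begin
    first + upper
      ≡⟨ sumTo-sucˡ N (λ i → ι (N C i) * w i (suc N ∸ i)) ⟨
    sumTo N (λ i → ι (N C i) * w i (suc N ∸ i)) + ι (N C suc N) * w (suc N) (N ∸ N)
      ≡⟨ cong (λ c → sumTo N (λ i → ι (N C i) * w i (suc N ∸ i)) + ι c * w (suc N) (N ∸ N)) (k>n⇒nCk≡0 (ℕP.n<1+n N)) ⟩
    sumTo N (λ i → ι (N C i) * w i (suc N ∸ i)) + 0ℚ * w (suc N) (N ∸ N)
      ≡⟨ cong (λ z → sumTo N (λ i → ι (N C i) * w i (suc N ∸ i)) + z) (*-zeroˡ (w (suc N) (N ∸ N))) ⟩
    sumTo N (λ i → ι (N C i) * w i (suc N ∸ i)) + 0ℚ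
      ≡⟨ +-identityʳ _ ⟩
    sumTo N (λ i → ι (N C i) * w i (suc N ∸ i))
      ≡⟨ sumTo-cong N (λ i i≤N → cong (λ j → ι (N C i) * w i j) (ℕP.+-∸-assoc 1 i≤N)) ⟩
    binomialSum N (λ i j → w i (suc j))
      ∎

binomial-theorem : ∀ N x y → binomialSum N (λ i j → x ^ℚ i * y ^ℚ j) ≡ (x + y) ^ℚ N
binomial-theorem zero    x y = refl
binomial-theorem (suc N) x y = begin
  binomialSum (suc N) (λ i j → x ^ℚ i * y ^ℚ j)
    ≡⟨ binomialSum-suc N xⁱyʲ ⟩
  binomialSum N (λ i j → x ^ℚ i * (y * y ^ℚ j)) + binomialSum N (λ i j → (x * x ^ℚ i) * y ^ℚ j)
    ≡⟨ cong₂ _+_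
         (binomialSum-cong N (λ i j → solve 3 (λ a y b → a :* (y :* b) := y :* (a :* b)) refl (x ^ℚ i) y (y ^ℚ j)))
         (binomialSum-cong N (λ i j → *-assoc x (x ^ℚ i) (y ^ℚ j))) ⟩
  binomialSum N (λ i j → y * (x ^ℚ i * y ^ℚ j)) + binomialSum N (λ i j → x * (x ^ℚ i * y ^ℚ j))
    ≡⟨ cong₂ _+_ (*-distribˡ-binomialSum N y xⁱyʲ) (*-distribˡ-binomialSum N x xⁱyʲ) ⟨
  y * binomialSum N (λ i j → x ^ℚ i * y ^ℚ j) + x * binomialSum N (λ i j → x ^ℚ i * y ^ℚ j)
    ≡⟨ cong₂ (λ u v → y * u + x * v) (binomial-theorem N x y) (binomial-theorem N x y) ⟩
  y * (x + y) ^ℚ N + x * (x + y) ^ℚ N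
    ≡⟨ solve 3 (λ x y p → y :* p :+ x :* p := (x :+ y) :* p) refl x y ((x + y) ^ℚ N) ⟩
  (x + y) ^ℚ suc N
    ∎
  where
  xⁱyʲ : ℕ → ℕ → ℚ
  xⁱyʲ i j = x ^ℚ i * y ^ℚ j

Δ : (ℕ → ℚ) → ℕ → ℚ
Δ f n = f (suc n) - f n

alternatingSum : ℕ → (ℕ → ℚ) → ℚ
alternatingSum N f = binomialSum N (λ i _ → -1ℚ ^ℚ i * f i)

alternatingSum-suc : ∀ N f → alternatingSum (suc N) f ≡ -1ℚ * alternatingSum N (Δ f)
alternatingSum-suc N f = begin
  alternatingSum (suc N) f
    ≡⟨ binomialSum-suc N (signed f) ⟩
  binomialSum N (λ i _ → -1ℚ ^ℚ i * f i) + binomialSum N (λ i _ → -1ℚ ^ℚ suc i * f (suc i))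
    ≡⟨ binomialSum-+ N (signed f) (λ i _ → -1ℚ ^ℚ suc i * f (suc i)) ⟨
  binomialSum N (λ i _ → -1ℚ ^ℚ i * f i + -1ℚ ^ℚ suc i * f (suc i))
    ≡⟨ binomialSum-cong N (λ i _ → solve 3 (λ s a b → s :* a :+ (con -1ℚ :* s) :* b := con -1ℚ :* (s :* (b :- a)))
                                          refl (-1ℚ ^ℚ i) (f i) (f (suc i))) ⟩
  binomialSum N (λ i _ → -1ℚ * (-1ℚ ^ℚ i * Δ f i))
    ≡⟨ *-distribˡ-binomialSum N -1ℚ (signed (Δ f)) ⟨
  -1ℚ * alternatingSum N (Δ f)
    ∎
  where
  signed : (ℕ → ℚ) → ℕ → ℕ → ℚ
  signed g i _ = -1ℚ ^ℚ i * g i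

DegreeBelow : ℕ → (ℕ → ℚ) → Set
DegreeBelow zero    f = ∀ n → f n ≡ 0ℚ
DegreeBelow (suc d) f = DegreeBelow d (Δ f)

alternatingSum-DegreeBelow : ∀ N f → DegreeBelow N f → alternatingSum N f ≡ 0ℚ
alternatingSum-DegreeBelow zero    f f≡0 = cong (λ z → 1ℚ * (1ℚ * z)) (f≡0 0)
alternatingSum-DegreeBelow (suc N) f deg = begin
  alternatingSum (suc N) f       ≡⟨ alternatingSum-suc N f ⟩
  -1ℚ * alternatingSum N (Δ f)   ≡⟨ cong (-1ℚ *_) (alternatingSum-DegreeBelow N (Δ f) deg) ⟩
  -1ℚ * 0ℚ                       ≡⟨ *-zeroʳ -1ℚ ⟩
  0ℚ                             ∎

DegreeBelow-cong : ∀ d {f g} → f ≗ g → DegreeBelow d f → DegreeBelow d g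
DegreeBelow-cong zero    f≗g f≡0 n = trans (sym (f≗g n)) (f≡0 n)
DegreeBelow-cong (suc d) f≗g deg   = DegreeBelow-cong d (λ n → cong₂ _-_ (f≗g (suc n)) (f≗g n)) deg

DegreeBelow-suc : ∀ d f → DegreeBelow d f → DegreeBelow (suc d) f
DegreeBelow-suc zero    f f≡0 n = cong₂ _-_ (f≡0 (suc n)) (f≡0 n)
DegreeBelow-suc (suc d) f deg   = DegreeBelow-suc d (Δ f) deg

DegreeBelow-mono : ∀ {d e} f → d ≤ e → DegreeBelow d f → DegreeBelow e f
DegreeBelow-mono {zero}  {zero}  f _         deg = deg
DegreeBelow-mono {zero}  {suc e} f _         deg = DegreeBelow-suc e f (DegreeBelow-mono {e = e} f z≤n deg)
DegreeBelow-mono {suc d} {suc e} f (s≤s d≤e) deg = DegreeBelow-mono (Δ f) d≤e deg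

DegreeBelow-shift : ∀ d f → DegreeBelow d f → DegreeBelow d (λ n → f (suc n))
DegreeBelow-shift zero    f f≡0 n = f≡0 (suc n)
DegreeBelow-shift (suc d) f deg   = DegreeBelow-shift d (Δ f) deg

DegreeBelow-+ : ∀ d f g → DegreeBelow d f → DegreeBelow d g → DegreeBelow d (λ n → f n + g n)
DegreeBelow-+ zero    f g f≡0 g≡0 n = cong₂ _+_ (f≡0 n) (g≡0 n)
DegreeBelow-+ (suc d) f g degf degg = DegreeBelow-cong d
  (λ n → solve 4 (λ a b c e → (a :- b) :+ (c :- e) := (a :+ c) :- (b :+ e)) refl (f (suc n)) (f n) (g (suc n)) (g n))
  (DegreeBelow-+ d (Δ f) (Δ g) degf degg)

DegreeBelow-ι* : ∀ d f → DegreeBelow d f → DegreeBelow (suc d) (λ n → ι n * f n)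
DegreeBelow-ι* zero    f f≡0 n = begin
  ι (suc n) * f (suc n) - ι n * f n  ≡⟨ cong₂ (λ a b → ι (suc n) * a - ι n * b) (f≡0 (suc n)) (f≡0 n) ⟩
  ι (suc n) * 0ℚ - ι n * 0ℚ          ≡⟨ solve 2 (λ a b → a :* con 0ℚ :- b :* con 0ℚ := con 0ℚ) refl (ι (suc n)) (ι n) ⟩
  0ℚ                                 ∎
DegreeBelow-ι* (suc d) f deg = DegreeBelow-cong (suc d) Δ[ι*f]
  (DegreeBelow-+ (suc d) (λ n → ι n * Δ f n) (λ n → f (suc n)) (DegreeBelow-ι* d (Δ f) deg) (DegreeBelow-shift (suc d) f deg))
  where
  Δ[ι*f] : ∀ n → ι n * Δ f n + f (suc n) ≡ ι (suc n) * f (suc n) - ι n * f n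
  Δ[ι*f] n = trans (solve 3 (λ a b c → a :* (b :- c) :+ b := (con 1ℚ :+ a) :* b :- a :* c) refl (ι n) (f (suc n)) (f n))
    (cong (λ z → z * f (suc n) - ι n * f n) (sym (ι-suc n)))

DegreeBelow-^ : ∀ p → DegreeBelow (suc p) (λ n → ι (n ^ p))
DegreeBelow-^ zero    n = +-inverseʳ 1ℚ
DegreeBelow-^ (suc p) = DegreeBelow-cong (suc (suc p)) (λ n → sym (ι-homo-* n (n ^ p)))
  (DegreeBelow-ι* (suc p) _ (DegreeBelow-^ p))

shift : PowerSeries → PowerSeries
shift c zero    = 0ℚ
shift c (suc i) = c i

shiftBy : ℕ → PowerSeries → PowerSeries
shiftBy zero    c = c
shiftBy (suc n) c = shift (shiftBy n c)

shiftBy-+ : ∀ n c r → shiftBy n c (n ℕ.+ r) ≡ c r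
shiftBy-+ zero    c r = refl
shiftBy-+ (suc n) c r = shiftBy-+ n c r

shiftBy-< : ∀ n c {N} → N < n → shiftBy n c N ≡ 0ℚ
shiftBy-< (suc n) c {zero}  _         = refl
shiftBy-< (suc n) c {suc N} (s≤s N<n) = shiftBy-< n c N<n

shift-cong : ∀ {a b} → a ≗ b → shift a ≗ shift b
shift-cong a≗b zero    = refl
shift-cong a≗b (suc i) = a≗b i

shiftBy-cong : ∀ n {a b} → a ≗ b → shiftBy n a ≗ shiftBy n b
shiftBy-cong zero    a≗b = a≗b
shiftBy-cong (suc n) a≗b = shift-cong (shiftBy-cong n a≗b)

⊛-cong : ∀ {a a′ b b′} → a ≗ a′ → b ≗ b′ → a ⊛ b ≗ a′ ⊛ b′
⊛-cong a≗a′ b≗b′ N = sumTo-cong N (λ i _ → cong₂ _*_ (a≗a′ i) (b≗b′ (N ∸ i)))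

pow-cong : ∀ n {a b} → a ≗ b → pow a n ≗ pow b n
pow-cong zero    a≗b _ = refl
pow-cong (suc n) a≗b   = ⊛-cong a≗b (pow-cong n a≗b)

shift-⊛ : ∀ a b → shift a ⊛ b ≗ shift (a ⊛ b)
shift-⊛ a b zero    = *-zeroˡ (b 0)
shift-⊛ a b (suc N) = begin
  (shift a ⊛ b) (suc N)       ≡⟨ sumTo-sucˡ N (λ i → shift a i * b (suc N ∸ i)) ⟩
  0ℚ * b (suc N) + (a ⊛ b) N  ≡⟨ cong (λ z → z + (a ⊛ b) N) (*-zeroˡ (b (suc N))) ⟩
  0ℚ + (a ⊛ b) N              ≡⟨ +-identityˡ _ ⟩
  (a ⊛ b) N                   ∎

⊛-shift : ∀ a b → a ⊛ shift b ≗ shift (a ⊛ b)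
⊛-shift a b zero    = *-zeroʳ (a 0)
⊛-shift a b (suc N) = begin
  (a ⊛ shift b) (suc N)
    ≡⟨ cong₂ _+_ (sumTo-cong N (λ i i≤N → cong (λ k → a i * shift b k) (ℕP.+-∸-assoc 1 i≤N)))
                 (cong (λ k → a (suc N) * shift b k) (ℕP.n∸n≡0 N)) ⟩
  (a ⊛ b) N + a (suc N) * 0ℚ
    ≡⟨ cong (λ z → (a ⊛ b) N + z) (*-zeroʳ (a (suc N))) ⟩
  (a ⊛ b) N + 0ℚ
    ≡⟨ +-identityʳ _ ⟩
  (a ⊛ b) N
    ∎

⊛-shiftBy : ∀ n a b → a ⊛ shiftBy n b ≗ shiftBy n (a ⊛ b)
⊛-shiftBy zero    a b _ = refl
⊛-shiftBy (suc n) a b N = trans (⊛-shift a (shiftBy n b) N) (shift-cong (⊛-shiftBy n a b) N)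

pow-shift : ∀ a n → pow (shift a) n ≗ shiftBy n (pow a n)
pow-shift a zero    _ = refl
pow-shift a (suc n) N = begin
  (shift a ⊛ pow (shift a) n) N      ≡⟨ ⊛-cong {shift a} (λ _ → refl) (pow-shift a n) N ⟩
  (shift a ⊛ shiftBy n (pow a n)) N  ≡⟨ shift-⊛ a (shiftBy n (pow a n)) N ⟩
  shift (a ⊛ shiftBy n (pow a n)) N  ≡⟨ shift-cong (⊛-shiftBy n a (pow a n)) N ⟩
  shiftBy (suc n) (pow a (suc n)) N  ∎

expSeries : ℚ → PowerSeries
expSeries x i = x ^ℚ i * 1/[ i !]

expSeries-⊛ : ∀ x y → expSeries x ⊛ expSeries y ≗ expSeries (x + y)
expSeries-⊛ x y N = begin
  (expSeries x ⊛ expSeries y) N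
    ≡⟨ sumTo-cong N term ⟩
  sumTo N (λ i → 1/[ N !] * (ι (N C i) * xⁱyʲ i (N ∸ i)))
    ≡⟨ *-distribˡ-sumTo N 1/[ N !] _ ⟨
  1/[ N !] * binomialSum N xⁱyʲ
    ≡⟨ cong (1/[ N !] *_) (binomial-theorem N x y) ⟩
  1/[ N !] * (x + y) ^ℚ N
    ≡⟨ *-comm 1/[ N !] _ ⟩
  expSeries (x + y) N
    ∎
  where
  xⁱyʲ : ℕ → ℕ → ℚ
  xⁱyʲ i j = x ^ℚ i * y ^ℚ j
  term : ∀ i → i ≤ N → expSeries x i * expSeries y (N ∸ i) ≡ 1/[ N !] * (ι (N C i) * xⁱyʲ i (N ∸ i))
  term i i≤N = begin
    (x ^ℚ i * 1/[ i !]) * (y ^ℚ (N ∸ i) * 1/[ (N ∸ i) !])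
      ≡⟨ solve 4 (λ a u b v → (a :* u) :* (b :* v) := (u :* v) :* (a :* b)) refl
           (x ^ℚ i) 1/[ i !] (y ^ℚ (N ∸ i)) 1/[ (N ∸ i) !] ⟩
    (1/[ i !] * 1/[ (N ∸ i) !]) * xⁱyʲ i (N ∸ i)
      ≡⟨ cong (_* xⁱyʲ i (N ∸ i)) (1/[!]-*-1/[!] i≤N) ⟩
    (1/[ N !] * ι (N C i)) * xⁱyʲ i (N ∸ i)
      ≡⟨ *-assoc 1/[ N !] (ι (N C i)) _ ⟩
    1/[ N !] * (ι (N C i) * xⁱyʲ i (N ∸ i))
      ∎

pow-expSeries : ∀ x n → pow (expSeries x) n ≗ expSeries (ι n * x)
pow-expSeries x zero zero    = refl
pow-expSeries x zero (suc N) = sym (begin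
  ((ι 0 * x) * (ι 0 * x) ^ℚ N) * 1/[ suc N !] ≡⟨ cong (λ z → (z * (ι 0 * x) ^ℚ N) * 1/[ suc N !]) (*-zeroˡ x) ⟩
  (0ℚ * (ι 0 * x) ^ℚ N) * 1/[ suc N !]        ≡⟨ cong (_* 1/[ suc N !]) (*-zeroˡ ((ι 0 * x) ^ℚ N)) ⟩
  0ℚ * 1/[ suc N !]                           ≡⟨ *-zeroˡ 1/[ suc N !] ⟩
  0ℚ                                          ∎)
pow-expSeries x (suc n) N = begin
  (expSeries x ⊛ pow (expSeries x) n) N       ≡⟨ ⊛-cong {expSeries x} (λ _ → refl) (pow-expSeries x n) N ⟩
  (expSeries x ⊛ expSeries (ι n * x)) N       ≡⟨ expSeries-⊛ x (ι n * x) N ⟩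
  expSeries (x + ι n * x) N                   ≡⟨ cong (λ z → expSeries z N) x+nx≡[1+n]x ⟩
  expSeries (ι (suc n) * x) N                 ∎
  where
  x+nx≡[1+n]x : x + ι n * x ≡ ι (suc n) * x
  x+nx≡[1+n]x = trans (solve 2 (λ x a → x :+ a :* x := (con 1ℚ :+ a) :* x) refl x (ι n))
    (cong (_* x) (sym (ι-suc n)))

expSeries-suc : ∀ x r → ι (suc r) * expSeries x (suc r) ≡ x * expSeries x r
expSeries-suc x r = begin
  ι (suc r) * (x ^ℚ suc r * 1/[ suc r !])
    ≡⟨ cong (λ z → ι (suc r) * (x ^ℚ suc r * z)) (1/ℕ-homo-* (suc r) (r !) {{_}} {{r !≢0}}) ⟩
  ι (suc r) * ((x * x ^ℚ r) * (1/ℕ (suc r) * 1/[ r !]))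
    ≡⟨ solve 5 (λ i x p u v → i :* ((x :* p) :* (u :* v)) := (i :* u) :* (x :* (p :* v))) refl
         (ι (suc r)) x (x ^ℚ r) (1/ℕ (suc r)) 1/[ r !] ⟩
  (ι (suc r) * 1/ℕ (suc r)) * (x * expSeries x r)
    ≡⟨ cong (_* (x * expSeries x r)) (ι-*-1/ℕ (suc r)) ⟩
  1ℚ * (x * expSeries x r)
    ≡⟨ *-identityˡ _ ⟩
  x * expSeries x r
    ∎

-- Coefficientwise, λ c′ = n c + x λ c for c = λⁿ e^{xλ}.
shiftBy-expSeries-euler : ∀ n x j →
  ι j * shiftBy n (expSeries x) j ≡ ι n * shiftBy n (expSeries x) j + x * shiftBy (suc n) (expSeries x) j
shiftBy-expSeries-euler zero    x zero    =
  sym (trans (cong (λ z → ι 0 * expSeries x 0 + z) (*-zeroʳ x)) (+-identityʳ _))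
shiftBy-expSeries-euler zero    x (suc r) =
  trans (expSeries-suc x r) (sym (trans (cong (_+ x * expSeries x r) (*-zeroˡ (expSeries x (suc r)))) (+-identityˡ _)))
shiftBy-expSeries-euler (suc n) x zero    =
  solve 3 (λ z a x → z :* con 0ℚ := a :* con 0ℚ :+ x :* con 0ℚ) refl (ι 0) (ι (suc n)) x
shiftBy-expSeries-euler (suc n) x (suc r) = begin
  ι (suc r) * c r                  ≡⟨ cong (_* c r) (ι-suc r) ⟩
  (1ℚ + ι r) * c r                 ≡⟨ *-distribʳ-+ (c r) 1ℚ (ι r) ⟩
  1ℚ * c r + ι r * c r             ≡⟨ cong (λ z → 1ℚ * c r + z) (shiftBy-expSeries-euler n x r) ⟩
  1ℚ * c r + (ι n * c r + x * d)   ≡⟨ solve 4 (λ c a x d → con 1ℚ :* c :+ (a :* c :+ x :* d) := (con 1ℚ :+ a) :* c :+ x :* d)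
                                        refl (c r) (ι n) x d ⟩
  (1ℚ + ι n) * c r + x * d         ≡⟨ cong (λ z → z * c r + x * d) (ι-suc n) ⟨
  ι (suc n) * c r + x * d          ∎
  where
  c = shiftBy n (expSeries x)
  d = shift c r

lamExpNeg≗shift-expSeries : lamExpNeg ≗ shift (expSeries -1ℚ)
lamExpNeg≗shift-expSeries zero    = refl
lamExpNeg≗shift-expSeries (suc _) = refl

pow-lamExpNeg : ∀ n → pow lamExpNeg n ≗ shiftBy n (expSeries (ι n * -1ℚ))
pow-lamExpNeg n N = begin
  pow lamExpNeg n N                           ≡⟨ pow-cong n lamExpNeg≗shift-expSeries N ⟩
  pow (shift (expSeries -1ℚ)) n N             ≡⟨ pow-shift (expSeries -1ℚ) n N ⟩
  shiftBy n (pow (expSeries -1ℚ) n) N         ≡⟨ shiftBy-cong n (pow-expSeries -1ℚ n) N ⟩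
  shiftBy n (expSeries (ι n * -1ℚ)) N         ∎

pow-lamExpNeg-< : ∀ {n N} → N < n → pow lamExpNeg n N ≡ 0ℚ
pow-lamExpNeg-< {n} {N} N<n = trans (pow-lamExpNeg n N) (shiftBy-< n _ N<n)

pow-lamExpNeg-+ : ∀ n r → pow lamExpNeg n (n ℕ.+ r) ≡ (ι (n ^ r) * -1ℚ ^ℚ r) * 1/[ r !]
pow-lamExpNeg-+ n r = begin
  pow lamExpNeg n (n ℕ.+ r)               ≡⟨ pow-lamExpNeg n (n ℕ.+ r) ⟩
  shiftBy n (expSeries (ι n * -1ℚ)) (n ℕ.+ r) ≡⟨ shiftBy-+ n _ r ⟩
  (ι n * -1ℚ) ^ℚ r * 1/[ r !]             ≡⟨ cong (_* 1/[ r !]) (^ℚ-distribʳ-* (ι n) -1ℚ r) ⟩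
  (ι n ^ℚ r * -1ℚ ^ℚ r) * 1/[ r !]        ≡⟨ cong (λ z → (z * -1ℚ ^ℚ r) * 1/[ r !]) (ι-homo-^ n r) ⟨
  (ι (n ^ r) * -1ℚ ^ℚ r) * 1/[ r !]       ∎

pow-lamExpNeg-euler : ∀ n j →
  ι (suc j) * pow lamExpNeg n (suc j) ≡ ι n * (pow lamExpNeg n (suc j) - pow lamExpNeg n j)
pow-lamExpNeg-euler n j = begin
  ι (suc j) * pow lamExpNeg n (suc j)  ≡⟨ cong (ι (suc j) *_) (pow-lamExpNeg n (suc j)) ⟩
  ι (suc j) * c (suc j)                ≡⟨ shiftBy-expSeries-euler n (ι n * -1ℚ) (suc j) ⟩
  ι n * c (suc j) + (ι n * -1ℚ) * c j  ≡⟨ solve 3 (λ a u v → a :* u :+ (a :* con -1ℚ) :* v := a :* (u :- v)) refl (ι n) (c (suc j)) (c j) ⟩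
  ι n * (c (suc j) - c j)              ≡⟨ cong₂ (λ u v → ι n * (u - v)) (pow-lamExpNeg n (suc j)) (pow-lamExpNeg n j) ⟨
  ι n * (pow lamExpNeg n (suc j) - pow lamExpNeg n j) ∎
  where
  c = shiftBy n (expSeries (ι n * -1ℚ))

m+[n∸m]≡n+[m∸n] : ∀ m n → m ℕ.+ (n ∸ m) ≡ n ℕ.+ (m ∸ n)
m+[n∸m]≡n+[m∸n] zero    n       = sym (trans (cong (n ℕ.+_) (ℕP.0∸n≡0 n)) (ℕP.+-identityʳ n))
m+[n∸m]≡n+[m∸n] (suc m) zero    = ℕP.+-identityʳ (suc m)
m+[n∸m]≡n+[m∸n] (suc m) (suc n) = cong suc (m+[n∸m]≡n+[m∸n] m n)

-- R m n = n^{n-m} / n!, multiplied by n^m because n - m may be negative.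
R-spec : ∀ m j → let n = suc j in ι (n ^ m) * R m n ≡ ι (n ^ n) * 1/[ n !]
R-spec m j = begin
  ι (n ^ m) * R m n
    ≡⟨ cong (ι (n ^ m) *_) (/-as-* (n ^ (n ∸ m)) (n ^ e ℕ.* n !)) ⟩
  ι (n ^ m) * (ι (n ^ (n ∸ m)) * 1/ℕ (n ^ e ℕ.* n !))
    ≡⟨ cong (λ z → ι (n ^ m) * (ι (n ^ (n ∸ m)) * z)) (1/ℕ-homo-* (n ^ e) (n !)) ⟩
  ι (n ^ m) * (ι (n ^ (n ∸ m)) * (1/ℕ (n ^ e) * 1/[ n !]))
    ≡⟨ solve 4 (λ a b u v → a :* (b :* (u :* v)) := (a :* b) :* u :* v) refl
         (ι (n ^ m)) (ι (n ^ (n ∸ m))) (1/ℕ (n ^ e)) 1/[ n !] ⟩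
  (ι (n ^ m) * ι (n ^ (n ∸ m))) * 1/ℕ (n ^ e) * 1/[ n !]
    ≡⟨ cong (λ z → z * 1/ℕ (n ^ e) * 1/[ n !]) exponents ⟩
  (ι (n ^ n) * ι (n ^ e)) * 1/ℕ (n ^ e) * 1/[ n !]
    ≡⟨ cong (λ z → z * 1/[ n !]) (*-assoc (ι (n ^ n)) (ι (n ^ e)) _) ⟩
  ι (n ^ n) * (ι (n ^ e) * 1/ℕ (n ^ e)) * 1/[ n !]
    ≡⟨ cong (λ z → ι (n ^ n) * z * 1/[ n !]) (ι-*-1/ℕ (n ^ e)) ⟩
  ι (n ^ n) * 1ℚ * 1/[ n !]
    ≡⟨ cong (_* 1/[ n !]) (*-identityʳ (ι (n ^ n))) ⟩
  ι (n ^ n) * 1/[ n !]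
    ∎
  where
  n = suc j
  e = m ∸ n
  instance
    nᵉ≢0 : NonZero (n ^ e)
    nᵉ≢0 = m^n≢0 n e
    n!≢0 : NonZero (n !)
    n!≢0 = n !≢0
    nᵉn!≢0 : NonZero (n ^ e ℕ.* n !)
    nᵉn!≢0 = ℕP.m*n≢0 (n ^ e) (n !)
  exponents : ι (n ^ m) * ι (n ^ (n ∸ m)) ≡ ι (n ^ n) * ι (n ^ e)
  exponents = begin
    ι (n ^ m) * ι (n ^ (n ∸ m))  ≡⟨ ι-homo-* (n ^ m) (n ^ (n ∸ m)) ⟨
    ι (n ^ m ℕ.* n ^ (n ∸ m))    ≡⟨ cong ι (ℕP.^-distribˡ-+-* n m (n ∸ m)) ⟨
    ι (n ^ (m ℕ.+ (n ∸ m)))      ≡⟨ cong (λ k → ι (n ^ k)) (m+[n∸m]≡n+[m∸n] m n) ⟩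
    ι (n ^ (n ℕ.+ e))            ≡⟨ cong ι (ℕP.^-distribˡ-+-* n n e) ⟩
    ι (n ^ n ℕ.* n ^ e)          ≡⟨ ι-homo-* (n ^ n) (n ^ e) ⟩
    ι (n ^ n) * ι (n ^ e)        ∎

ι*R-suc : ∀ m n → ι n * R (suc m) n ≡ R m n
ι*R-suc m zero    = *-zeroʳ (ι 0)
ι*R-suc m (suc j) = ι-cancelˡ (n ^ m) {{m^n≢0 n m}} (begin
  ι (n ^ m) * (ι n * R (suc m) n)   ≡⟨ *-assoc (ι (n ^ m)) (ι n) _ ⟨
  (ι (n ^ m) * ι n) * R (suc m) n   ≡⟨ cong (_* R (suc m) n) (ι-homo-* (n ^ m) n) ⟨
  ι (n ^ m ℕ.* n) * R (suc m) n     ≡⟨ cong (λ k → ι k * R (suc m) n) (ℕP.*-comm (n ^ m) n) ⟩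
  ι (n ^ suc m) * R (suc m) n       ≡⟨ R-spec (suc m) j ⟩
  ι (n ^ n) * 1/[ n !]              ≡⟨ R-spec m j ⟨
  ι (n ^ m) * R m n                 ∎)
  where n = suc j

-- Differs from n ↦ n ^ p only at n = 0 when p = 0 (0 ^ 0 = 1): this defect is the
-- nonzero leading coefficient of G_m.
pow⁺ : ℕ → ℕ → ℚ
pow⁺ p zero    = 0ℚ
pow⁺ p (suc n) = ι (suc n ^ p)

R*pow-lamExpNeg : ∀ m p n → n ≤ m ℕ.+ p → let N = m ℕ.+ p in
  R m n * pow lamExpNeg n N ≡ (-1ℚ ^ℚ N * 1/[ N !]) * (ι (N C n) * (-1ℚ ^ℚ n * pow⁺ p n))
R*pow-lamExpNeg m p zero    _   = trans (*-zeroˡ (one (m ℕ.+ p)))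
  (solve 2 (λ κ c → con 0ℚ := κ :* (c :* (con 1ℚ :* con 0ℚ))) refl
    (-1ℚ ^ℚ (m ℕ.+ p) * 1/[ (m ℕ.+ p) !]) (ι ((m ℕ.+ p) C 0)))
R*pow-lamExpNeg m p (suc j) n≤N = ι-cancelˡ (n ^ m) {{m^n≢0 n m}} (begin
  ι (n ^ m) * (R m n * pow lamExpNeg n N)
    ≡⟨ *-assoc (ι (n ^ m)) (R m n) _ ⟨
  (ι (n ^ m) * R m n) * pow lamExpNeg n N
    ≡⟨ cong₂ _*_ (R-spec m j) (trans (cong (pow lamExpNeg n) (sym n+r≡N)) (pow-lamExpNeg-+ n r)) ⟩
  (ι (n ^ n) * 1/[ n !]) * ((ι (n ^ r) * -1ℚ ^ℚ r) * 1/[ r !])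
    ≡⟨ solve 5 (λ a u b s v → (a :* u) :* ((b :* s) :* v) := (a :* b) :* (s :* (u :* v))) refl
         (ι (n ^ n)) 1/[ n !] (ι (n ^ r)) (-1ℚ ^ℚ r) 1/[ r !] ⟩
  (ι (n ^ n) * ι (n ^ r)) * (-1ℚ ^ℚ r * (1/[ n !] * 1/[ r !]))
    ≡⟨ cong₂ (λ a b → a * (-1ℚ ^ℚ r * b)) exponents (1/[!]-*-1/[!] n≤N) ⟩
  (ι (n ^ m) * ι (n ^ p)) * (-1ℚ ^ℚ r * (1/[ N !] * ι (N C n)))
    ≡⟨ cong (λ s → (ι (n ^ m) * ι (n ^ p)) * (s * (1/[ N !] * ι (N C n)))) (-1^N*-1^n≡-1^[N∸n] n≤N) ⟨
  (ι (n ^ m) * ι (n ^ p)) * ((-1ℚ ^ℚ N * -1ℚ ^ℚ n) * (1/[ N !] * ι (N C n)))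
    ≡⟨ solve 6 (λ a b s t u c → (a :* b) :* ((s :* t) :* (u :* c)) := a :* ((s :* u) :* (c :* (t :* b)))) refl
         (ι (n ^ m)) (ι (n ^ p)) (-1ℚ ^ℚ N) (-1ℚ ^ℚ n) 1/[ N !] (ι (N C n)) ⟩
  ι (n ^ m) * ((-1ℚ ^ℚ N * 1/[ N !]) * (ι (N C n) * (-1ℚ ^ℚ n * pow⁺ p n)))
    ∎)
  where
  n = suc j
  N = m ℕ.+ p
  r = N ∸ n
  n+r≡N : n ℕ.+ r ≡ N
  n+r≡N = ℕP.m+[n∸m]≡n n≤N
  exponents : ι (n ^ n) * ι (n ^ r) ≡ ι (n ^ m) * ι (n ^ p)
  exponents = begin
    ι (n ^ n) * ι (n ^ r)   ≡⟨ ι-homo-* (n ^ n) (n ^ r) ⟨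
    ι (n ^ n ℕ.* n ^ r)     ≡⟨ cong ι (ℕP.^-distribˡ-+-* n n r) ⟨
    ι (n ^ (n ℕ.+ r))       ≡⟨ cong (λ k → ι (n ^ k)) n+r≡N ⟩
    ι (n ^ (m ℕ.+ p))       ≡⟨ cong ι (ℕP.^-distribˡ-+-* n m p) ⟩
    ι (n ^ m ℕ.* n ^ p)     ≡⟨ ι-homo-* (n ^ m) (n ^ p) ⟩
    ι (n ^ m) * ι (n ^ p)   ∎

G-coefficient : ∀ m p → let N = m ℕ.+ p in
  G m N ≡ (-1ℚ ^ℚ N * 1/[ N !]) * alternatingSum N (pow⁺ p)
G-coefficient m p = trans (sumTo-cong N (R*pow-lamExpNeg m p))
  (sym (*-distribˡ-sumTo N (-1ℚ ^ℚ N * 1/[ N !]) _))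
  where N = m ℕ.+ p

G-vanishes : ∀ m k → suc m < k → G (suc m) k ≡ 0ℚ
G-vanishes m k m<k with ℕP.m≤n⇒∃[o]m+o≡n m<k
... | q , refl = begin
  G (suc m) (suc (suc m ℕ.+ q))
    ≡⟨ cong (G (suc m)) (ℕP.+-suc (suc m) q) ⟨
  G (suc m) N
    ≡⟨ G-coefficient (suc m) (suc q) ⟩
  (-1ℚ ^ℚ N * 1/[ N !]) * alternatingSum N (pow⁺ (suc q))
    ≡⟨ cong ((-1ℚ ^ℚ N * 1/[ N !]) *_) (alternatingSum-DegreeBelow N (pow⁺ (suc q)) degree) ⟩
  (-1ℚ ^ℚ N * 1/[ N !]) * 0ℚ
    ≡⟨ *-zeroʳ (-1ℚ ^ℚ N * 1/[ N !]) ⟩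
  0ℚ
    ∎
  where
  N = suc m ℕ.+ suc q
  pow⁺≗pow : (λ n → ι (n ^ suc q)) ≗ pow⁺ (suc q)
  pow⁺≗pow zero    = refl
  pow⁺≗pow (suc n) = refl
  degree : DegreeBelow N (pow⁺ (suc q))
  degree = DegreeBelow-cong N pow⁺≗pow
    (DegreeBelow-mono (λ n → ι (n ^ suc q)) (s≤s (ℕP.m≤n+m (suc q) m)) (DegreeBelow-^ (suc q)))

alternatingSum-pow⁺0 : ∀ N → alternatingSum (suc N) (pow⁺ 0) ≡ -1ℚ
alternatingSum-pow⁺0 N = begin
  alternatingSum (suc N) (pow⁺ 0)    ≡⟨ sumTo-sucˡ N _ ⟩
  0ℚ + rest                          ≡⟨ solve 1 (λ x → con 0ℚ :+ x := (con 1ℚ :+ x) :- con 1ℚ) refl rest ⟩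
  (1ℚ + rest) - 1ℚ                   ≡⟨ cong (_- 1ℚ) (sumTo-sucˡ N _) ⟨
  alternatingSum (suc N) (λ _ → 1ℚ) - 1ℚ
    ≡⟨ cong (_- 1ℚ) (alternatingSum-DegreeBelow (suc N) (λ _ → 1ℚ)
         (DegreeBelow-mono (λ _ → 1ℚ) (s≤s (z≤n {N})) (λ _ → +-inverseʳ 1ℚ))) ⟩
  0ℚ - 1ℚ                            ∎
  where
  rest = sumTo N (λ i → ι (suc N C suc i) * (-1ℚ ^ℚ suc i * 1ℚ))

G-diagonal : ∀ m → let M = suc m in G M M ≡ (-1ℚ ^ℚ M * 1/[ M !]) * -1ℚ
G-diagonal m = begin
  G M M                                                ≡⟨ cong (G M) (ℕP.+-identityʳ M) ⟨
  G M (M ℕ.+ 0)                                        ≡⟨ G-coefficient M 0 ⟩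
  (-1ℚ ^ℚ (M ℕ.+ 0) * 1/[ (M ℕ.+ 0) !]) * alternatingSum (M ℕ.+ 0) (pow⁺ 0)
    ≡⟨ cong (λ N → (-1ℚ ^ℚ N * 1/[ N !]) * alternatingSum N (pow⁺ 0)) (ℕP.+-identityʳ M) ⟩
  (-1ℚ ^ℚ M * 1/[ M !]) * alternatingSum M (pow⁺ 0)    ≡⟨ cong ((-1ℚ ^ℚ M * 1/[ M !]) *_) (alternatingSum-pow⁺0 m) ⟩
  (-1ℚ ^ℚ M * 1/[ M !]) * -1ℚ                          ∎
  where M = suc m

G-diagonal≢0 : ∀ m → G (suc m) (suc m) ≢ 0ℚ
G-diagonal≢0 m G≡0 = 1ℚ≢0ℚ (begin
  1ℚ                               ≡⟨ cong₂ _*_ (-1^n*-1^n≡1 M) (ι-*-1/ℕ (M !) {{M !≢0}}) ⟨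
  (s * s) * (ι (M !) * 1/[ M !])   ≡⟨ solve 3 (λ s f v → (s :* s) :* (f :* v) := ((s :* f) :* con -1ℚ) :* ((s :* v) :* con -1ℚ))
                                        refl s (ι (M !)) 1/[ M !] ⟩
  inverse * ((s * 1/[ M !]) * -1ℚ)  ≡⟨ cong (inverse *_) (G-diagonal m) ⟨
  inverse * G M M                   ≡⟨ cong (inverse *_) G≡0 ⟩
  inverse * 0ℚ                      ≡⟨ *-zeroʳ inverse ⟩
  0ℚ                                ∎)
  where
  M = suc m
  s = -1ℚ ^ℚ M
  inverse = (s * ι (M !)) * -1ℚ
  1ℚ≢0ℚ : 1ℚ ≢ 0ℚ
  1ℚ≢0ℚ ()

G-recurrence : ∀ m j → ι (suc j) * G (suc m) (suc j) ≡ G m (suc j) - G m j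
G-recurrence m j = begin
  ι k * G (suc m) k
    ≡⟨ *-distribˡ-sumTo k (ι k) _ ⟩
  sumTo k (λ n → ι k * (R (suc m) n * P n k))
    ≡⟨ sumTo-cong k (λ n _ → term n) ⟩
  sumTo k (λ n → R m n * P n k - R m n * P n j)
    ≡⟨ sumTo-- k _ _ ⟩
  G m k - (G m j + R m k * P k j)
    ≡⟨ cong (λ z → G m k - (G m j + R m k * z)) (pow-lamExpNeg-< (ℕP.n<1+n j)) ⟩
  G m k - (G m j + R m k * 0ℚ)
    ≡⟨ cong (λ z → G m k - (G m j + z)) (*-zeroʳ (R m k)) ⟩
  G m k - (G m j + 0ℚ)
    ≡⟨ cong (λ z → G m k - z) (+-identityʳ (G m j)) ⟩
  G m k - G m j
    ∎
  where
  k = suc j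
  P = pow lamExpNeg
  term : ∀ n → ι k * (R (suc m) n * P n k) ≡ R m n * P n k - R m n * P n j
  term n = begin
    ι k * (R (suc m) n * P n k)         ≡⟨ solve 3 (λ a r p → a :* (r :* p) := r :* (a :* p)) refl (ι k) (R (suc m) n) (P n k) ⟩
    R (suc m) n * (ι k * P n k)         ≡⟨ cong (R (suc m) n *_) (pow-lamExpNeg-euler n j) ⟩
    R (suc m) n * (ι n * (P n k - P n j)) ≡⟨ solve 3 (λ r a d → r :* (a :* d) := (a :* r) :* d) refl (R (suc m) n) (ι n) (P n k - P n j) ⟩
    (ι n * R (suc m) n) * (P n k - P n j) ≡⟨ cong (_* (P n k - P n j)) (ι*R-suc m n) ⟩
    R m n * (P n k - P n j)             ≡⟨ *-distribˡ-+ (R m n) (P n k) (- P n j) ⟩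
    R m n * P n k + R m n * - P n j     ≡⟨ cong (λ z → R m n * P n k + z) (neg-distribʳ-* (R m n) (P n j)) ⟨
    R m n * P n k - R m n * P n j       ∎

g-via-G : ∀ m j → g m j ≡ - -1ℚ ^ℚ j * G m j
g-via-G m zero    = refl
g-via-G m (suc i) = cong (_* G m (suc i)) (solve 1 (λ s → s := :- (con -1ℚ :* s)) refl (-1ℚ ^ℚ i))

g-recurrence : ∀ m j → ι (suc j) * g (suc m) (suc j) ≡ g m (suc j) + g m j
g-recurrence m j = begin
  ι (suc j) * (s * G (suc m) (suc j))     ≡⟨ solve 3 (λ a s x → a :* (s :* x) := s :* (a :* x)) refl (ι (suc j)) s (G (suc m) (suc j)) ⟩
  s * (ι (suc j) * G (suc m) (suc j))     ≡⟨ cong (s *_) (G-recurrence m j) ⟩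
  s * (G m (suc j) - G m j)               ≡⟨ solve 3 (λ s x y → s :* (x :- y) := s :* x :+ (:- s) :* y) refl s (G m (suc j)) (G m j) ⟩
  s * G m (suc j) + - s * G m j           ≡⟨ cong (λ z → s * G m (suc j) + z) (g-via-G m j) ⟨
  g m (suc j) + g m j                     ∎
  where s = -1ℚ ^ℚ j

corollary2 :
    ((m : ℕ) → 0 < m →
      (G m 0 ≡ 0ℚ) × (G m m ≢ 0ℚ) × ((k : ℕ) → m < k → G m k ≡ 0ℚ))
    × ((m k : ℕ) → 1 < m → 1 ≤ k → k ≤ m →
      ((+ k) / 1) * g m k ≡ g (m ∸ 1) k + g (m ∸ 1) (k ∸ 1))
corollary2 = degree-and-leading-coefficient , recurrence
  where
  degree-and-leading-coefficient : (m : ℕ) → 0 < m → (G m 0 ≡ 0ℚ) × (G m m ≢ 0ℚ) × ((k : ℕ) → m < k → G m k ≡ 0ℚ)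
  degree-and-leading-coefficient (suc m) _ = refl , G-diagonal≢0 m , G-vanishes m
  recurrence : (m k : ℕ) → 1 < m → 1 ≤ k → k ≤ m → ((+ k) / 1) * g m k ≡ g (m ∸ 1) k + g (m ∸ 1) (k ∸ 1)
  recurrence (suc m) (suc j) _ _ _ = g-recurrence m j
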